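{- Let $E$ be a finite set, $e\in E$, and let $S\subseteq 2^E$ have $e$ as a frame, meaning: $\emptyset\in S$, $\{e\}\notin S$, and $e\in Y$ for every nonempty $Y\in S$. Let $S\setminus e:=\{Y\setminus\{e\}\mid Y\in S\}\subseteq 2^{E\setminus\{e\}}$. Then $S\setminus e$ is a powerful set (with ground set $E\setminus\{e\}$) if and only if $S$ is a powerful set.
   Context: For a finite ground set $E$, a family $S\subseteq 2^E$ is called a powerful set if for every $X\subseteq E$ the number of members $Y\in S$ with $Y\cap X=\emptyset$ is a power of $2$. -}

module Defs where

open import Data.Nat using (ℕ; zero; suc; _^_)
open import Data.Bool using (Bool; true; false; _∧_; if_then_else_)
open import Data.Bool.Properties using () renaming (_≟_ to _≟ᵇ_)
open import Data.Fin using (Fin)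
open import Data.Fin.Subset using (Subset; _∩_; ⊥; ⁅_⁆; _∈_)
open import Data.Vec using (Vec; []; _∷_; removeAt)
open import Data.Vec.Properties using (≡-dec)
open import Data.List using (List; []; _∷_; map; _++_; filter; length)
open import Data.Bool.ListAction using (any)
open import Data.Product using (∃)
open import Relation.Binary.PropositionalEquality using (_≡_; _≢_)
open import Relation.Nullary.Decidable using (⌊_⌋)

allSubsets : (n : ℕ) → List (Subset n)
allSubsets zero = [] ∷ []
allSubsets (suc n) = map (true ∷_) (allSubsets n) ++ map (false ∷_) (allSubsets n)

_≟ˢ_ : {n : ℕ} → (A B : Subset n) → Bool
A ≟ˢ B = ⌊ ≡-dec _≟ᵇ_ A B ⌋

Family : ℕ → Set
Family n = Subset n → Bool

disjoint : {n : ℕ} → Subset n → Subset n → Bool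
disjoint Y X = (Y ∩ X) ≟ˢ ⊥

countDisjoint : {n : ℕ} → Family n → Subset n → ℕ
countDisjoint {n} S X = length (filter (λ Y → S Y ∧ disjoint Y X ≟ᵇ true) (allSubsets n))

Powerful : {n : ℕ} → Family n → Set
Powerful {n} S = (X : Subset n) → ∃ λ k → countDisjoint S X ≡ 2 ^ k

Frame : {n : ℕ} → Family (suc n) → Fin (suc n) → Set
Frame {n} S e =
  (S ⊥ ≡ true) × (S ⁅ e ⁆ ≡ false) × ((Y : Subset (suc n)) → S Y ≡ true → Y ≢ ⊥ → e ∈ Y)
  where open import Data.Product using (_×_)

-- S ∖ e = { Y ∖ {e} | Y ∈ S }, as a family on E ∖ {e} ≅ Fin n
-- (removeAt deletes coordinate e, identifying E ∖ {e} with Fin n order-preservingly).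
deleteFamily : {n : ℕ} → Family (suc n) → Fin (suc n) → Family n
deleteFamily {n} S e Z = any (λ Y → S Y ∧ (removeAt Y e ≟ˢ Z)) (allSubsets (suc n))

-- Every subset of E = Fin (suc n) is insertAt X e b for a unique X ⊆ E ∖ {e} ≅ Fin n.
-- By the frame conditions, S ∖ e consists of ∅ and the X with X ∪ {e} ∈ S, and these
-- never coincide because {e} ∉ S.  Hence for X ∌ e the members of S disjoint from X
-- correspond one-to-one to those of S ∖ e, while ∅ is the only member of S disjoint
-- from X ∪ {e}, a count of 1 = 2 ^ 0.
module Submission where

open import Defs
open import Algebra.Bundles using (CommutativeMonoid)
open import Data.Bool using (Bool; true; false; _∧_; _∨_; not; if_then_else_)
open import Data.Bool.Properties
  using (∧-identityʳ; ∧-zeroʳ; ¬-not; ∨-commutativeMonoid)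
  renaming (_≟_ to _≟ᵇ_)
open import Data.Bool.ListAction using (any)
open import Data.Fin using (Fin; zero; suc)
open import Data.Fin.Subset using (Subset; _∩_; ⊥; ⁅_⁆; _∈_)
open import Data.List using (List; []; _∷_; _++_; map; filter; length)
open import Data.List.Effectful.Foldable using (foldMap; ++-homo)
open import Data.Nat using (ℕ; zero; suc; _+_; _^_; +-0-rawMonoid)
open import Data.Nat.Properties using (+-identityʳ; +-0-commutativeMonoid)
open import Data.Product using (∃; _,_; proj₁; proj₂; map₂)
open import Data.Vec using (Vec; []; _∷_; insertAt; removeAt; lookup)
open import Data.Vec.Properties
  using (≡-dec; insertAt-lookup; removeAt-insertAt; insertAt-removeAt; []=⇒lookup)
open import Function using (_∘_)
open import Function.Bundles using (_⇔_; mk⇔)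
open import Relation.Nullary using (yes; no)
open import Relation.Nullary.Decidable using (⌊_⌋; isYes≗does; dec-true)
open import Relation.Binary.PropositionalEquality
  using (_≡_; _≢_; refl; sym; trans; cong; cong₂; subst; module ≡-Reasoning)

≟ˢ-refl : {n : ℕ} (X : Subset n) → (X ≟ˢ X) ≡ true
≟ˢ-refl X = trans (isYes≗does (≡-dec _≟ᵇ_ X X)) (dec-true (≡-dec _≟ᵇ_ X X) refl)

≟ˢ⇒≡ : {n : ℕ} {X Y : Subset n} → (X ≟ˢ Y) ≡ true → X ≡ Y
≟ˢ⇒≡ {X = X} {Y} X≟Y with ≡-dec _≟ᵇ_ X Y | X≟Y
... | yes X≡Y | _ = X≡Y
... | no _    | ()

∷-≟ˢ-∷ : {n : ℕ} (x y : Bool) (X Y : Subset n) → ((x ∷ X) ≟ˢ (y ∷ Y)) ≡ ⌊ x ≟ᵇ y ⌋ ∧ (X ≟ˢ Y)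
∷-≟ˢ-∷ true  false X Y = refl
∷-≟ˢ-∷ false true  X Y = refl
∷-≟ˢ-∷ true  true  X Y with ≡-dec _≟ᵇ_ X Y
... | yes _ = refl
... | no  _ = refl
∷-≟ˢ-∷ false false X Y with ≡-dec _≟ᵇ_ X Y
... | yes _ = refl
... | no  _ = refl

module SubsetSum {c ℓ} (M : CommutativeMonoid c ℓ) where

  open CommutativeMonoid M hiding (refl; sym; trans)
  open CommutativeMonoid M using () renaming (refl to ≈-refl; trans to ≈-trans)
  open import Algebra.Properties.CommutativeSemigroup commutativeSemigroup using (interchange)
  open import Relation.Binary.Reasoning.Setoid setoid

  ⨁ : {n : ℕ} → (Subset n → Carrier) → Carrier
  ⨁ {zero}  f = f []
  ⨁ {suc n} f = ⨁ (f ∘ (true ∷_)) ∙ ⨁ (f ∘ (false ∷_))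

  ⨁-cong : {n : ℕ} {f g : Subset n → Carrier} → (∀ W → f W ≈ g W) → ⨁ f ≈ ⨁ g
  ⨁-cong {zero}  f≈g = f≈g []
  ⨁-cong {suc n} f≈g = ∙-cong (⨁-cong (f≈g ∘ (true ∷_))) (⨁-cong (f≈g ∘ (false ∷_)))

  ⨁-ε : {n : ℕ} → ⨁ {n} (λ _ → ε) ≈ ε
  ⨁-ε {zero}  = ≈-refl
  ⨁-ε {suc n} = ≈-trans (∙-cong (⨁-ε {n}) (⨁-ε {n})) (identityˡ ε)

  ⨁-∙ : {n : ℕ} (f g : Subset n → Carrier) → ⨁ (λ W → f W ∙ g W) ≈ ⨁ f ∙ ⨁ g
  ⨁-∙ {zero}  f g = ≈-refl
  ⨁-∙ {suc n} f g = begin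
    ⨁ (λ W → f (true ∷ W) ∙ g (true ∷ W)) ∙ ⨁ (λ W → f (false ∷ W) ∙ g (false ∷ W))
      ≈⟨ ∙-cong (⨁-∙ (f ∘ (true ∷_)) (g ∘ (true ∷_))) (⨁-∙ (f ∘ (false ∷_)) (g ∘ (false ∷_))) ⟩
    (⨁ (f ∘ (true ∷_)) ∙ ⨁ (g ∘ (true ∷_))) ∙ (⨁ (f ∘ (false ∷_)) ∙ ⨁ (g ∘ (false ∷_)))
      ≈⟨ interchange _ _ _ _ ⟩
    ⨁ f ∙ ⨁ g ∎

  ⨁-insertAt : {n : ℕ} (e : Fin (suc n)) (f : Subset (suc n) → Carrier) →
    ⨁ f ≈ ⨁ (λ W → f (insertAt W e true)) ∙ ⨁ (λ W → f (insertAt W e false))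
  ⨁-insertAt zero f = ≈-refl
  ⨁-insertAt {suc n} (suc e) f = begin
    ⨁ (f ∘ (true ∷_)) ∙ ⨁ (f ∘ (false ∷_))
      ≈⟨ ∙-cong (⨁-insertAt e (f ∘ (true ∷_))) (⨁-insertAt e (f ∘ (false ∷_))) ⟩
    (⨁ (λ W → f (true ∷ insertAt W e true)) ∙ ⨁ (λ W → f (true ∷ insertAt W e false))) ∙
    (⨁ (λ W → f (false ∷ insertAt W e true)) ∙ ⨁ (λ W → f (false ∷ insertAt W e false)))
      ≈⟨ interchange _ _ _ _ ⟩
    ⨁ (λ W → f (insertAt W (suc e) true)) ∙ ⨁ (λ W → f (insertAt W (suc e) false)) ∎

  ⨁-delta : {n : ℕ} (f : Subset n → Carrier) (Z : Subset n) →
    ⨁ (λ W → if W ≟ˢ Z then f W else ε) ≈ f Z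
  ⨁-delta f [] = ≈-refl
  ⨁-delta {suc n} f (true ∷ Z) = begin
    ⨁ (λ W → if (true ∷ W) ≟ˢ (true ∷ Z) then f (true ∷ W) else ε) ∙
    ⨁ (λ W → if (false ∷ W) ≟ˢ (true ∷ Z) then f (false ∷ W) else ε)
      ≈⟨ ∙-cong (⨁-cong λ W → reflexive (cong (λ b → if b then f (true ∷ W) else ε) (∷-≟ˢ-∷ true true W Z)))
                (⨁-cong λ W → reflexive (cong (λ b → if b then f (false ∷ W) else ε) (∷-≟ˢ-∷ false true W Z))) ⟩
    ⨁ (λ W → if W ≟ˢ Z then f (true ∷ W) else ε) ∙ ⨁ {n} (λ _ → ε)
      ≈⟨ ∙-cong (⨁-delta (f ∘ (true ∷_)) Z) (⨁-ε {n}) ⟩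
    f (true ∷ Z) ∙ ε
      ≈⟨ identityʳ _ ⟩
    f (true ∷ Z) ∎
  ⨁-delta {suc n} f (false ∷ Z) = begin
    ⨁ (λ W → if (true ∷ W) ≟ˢ (false ∷ Z) then f (true ∷ W) else ε) ∙
    ⨁ (λ W → if (false ∷ W) ≟ˢ (false ∷ Z) then f (false ∷ W) else ε)
      ≈⟨ ∙-cong (⨁-cong λ W → reflexive (cong (λ b → if b then f (true ∷ W) else ε) (∷-≟ˢ-∷ true false W Z)))
                (⨁-cong λ W → reflexive (cong (λ b → if b then f (false ∷ W) else ε) (∷-≟ˢ-∷ false false W Z))) ⟩
    ⨁ {n} (λ _ → ε) ∙ ⨁ (λ W → if W ≟ˢ Z then f (false ∷ W) else ε)
      ≈⟨ ∙-cong (⨁-ε {n}) (⨁-delta (f ∘ (false ∷_)) Z) ⟩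
    ε ∙ f (false ∷ Z)
      ≈⟨ identityˡ _ ⟩
    f (false ∷ Z) ∎

  foldMap-map : {A B : Set} (f : B → Carrier) (g : A → B) (xs : List A) →
    foldMap rawMonoid f (map g xs) ≈ foldMap rawMonoid (f ∘ g) xs
  foldMap-map f g []       = ≈-refl
  foldMap-map f g (x ∷ xs) = ∙-congˡ (foldMap-map f g xs)

  foldMap-allSubsets : {n : ℕ} (f : Subset n → Carrier) → foldMap rawMonoid f (allSubsets n) ≈ ⨁ f
  foldMap-allSubsets {zero}  f = identityʳ (f [])
  foldMap-allSubsets {suc n} f = begin
    foldMap rawMonoid f (map (true ∷_) (allSubsets n) ++ map (false ∷_) (allSubsets n))
      ≈⟨ ++-homo monoid f (map (true ∷_) (allSubsets n)) ⟩
    foldMap rawMonoid f (map (true ∷_) (allSubsets n)) ∙ foldMap rawMonoid f (map (false ∷_) (allSubsets n))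
      ≈⟨ ∙-cong (≈-trans (foldMap-map f (true ∷_) (allSubsets n)) (foldMap-allSubsets (f ∘ (true ∷_))))
                (≈-trans (foldMap-map f (false ∷_) (allSubsets n)) (foldMap-allSubsets (f ∘ (false ∷_)))) ⟩
    ⨁ f ∎

𝟙 : Bool → ℕ
𝟙 b = if b then 1 else 0

module Count = SubsetSum +-0-commutativeMonoid
module Any   = SubsetSum ∨-commutativeMonoid

length-filter-foldMap : {A : Set} (g : A → Bool) (xs : List A) →
  length (filter (λ x → g x ≟ᵇ true) xs) ≡ foldMap +-0-rawMonoid (𝟙 ∘ g) xs
length-filter-foldMap g [] = refl
length-filter-foldMap g (x ∷ xs) with g x
... | true  = cong suc (length-filter-foldMap g xs)
... | false = length-filter-foldMap g xs

any-foldMap : {A : Set} (g : A → Bool) (xs : List A) →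
  any g xs ≡ foldMap (CommutativeMonoid.rawMonoid ∨-commutativeMonoid) g xs
any-foldMap g []       = refl
any-foldMap g (x ∷ xs) = cong (g x ∨_) (any-foldMap g xs)

countDisjoint-⨁ : {n : ℕ} (S : Family n) (X : Subset n) →
  countDisjoint S X ≡ Count.⨁ (λ Y → 𝟙 (S Y ∧ disjoint Y X))
countDisjoint-⨁ {n} S X = trans (length-filter-foldMap (λ Y → S Y ∧ disjoint Y X) (allSubsets n))
                                (Count.foldMap-allSubsets (λ Y → 𝟙 (S Y ∧ disjoint Y X)))

deleteFamily-⨁ : {n : ℕ} (S : Family (suc n)) (e : Fin (suc n)) (Z : Subset n) →
  deleteFamily S e Z ≡ Any.⨁ (λ Y → S Y ∧ (removeAt Y e ≟ˢ Z))
deleteFamily-⨁ {n} S e Z = trans (any-foldMap (λ Y → S Y ∧ (removeAt Y e ≟ˢ Z)) (allSubsets (suc n)))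
                                 (Any.foldMap-allSubsets (λ Y → S Y ∧ (removeAt Y e ≟ˢ Z)))

insertAt-⊥ : {n : ℕ} (e : Fin (suc n)) → insertAt ⊥ e false ≡ ⊥
insertAt-⊥ zero = refl
insertAt-⊥ {suc n} (suc e) = cong (false ∷_) (insertAt-⊥ e)

⁅⁆≡insertAt-⊥ : {n : ℕ} (e : Fin (suc n)) → ⁅ e ⁆ ≡ insertAt ⊥ e true
⁅⁆≡insertAt-⊥ zero = refl
⁅⁆≡insertAt-⊥ {suc n} (suc e) = cong (false ∷_) (⁅⁆≡insertAt-⊥ e)

insertAt-∩ : {n : ℕ} (W X : Subset n) (e : Fin (suc n)) (b c : Bool) →
  insertAt W e b ∩ insertAt X e c ≡ insertAt (W ∩ X) e (b ∧ c)
insertAt-∩ W X zero b c = refl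
insertAt-∩ (w ∷ W) (x ∷ X) (suc e) b c = cong ((w ∧ x) ∷_) (insertAt-∩ W X e b c)

insertAt-≟ˢ-⊥ : {n : ℕ} (W : Subset n) (e : Fin (suc n)) (b : Bool) →
  (insertAt W e b ≟ˢ ⊥) ≡ not b ∧ (W ≟ˢ ⊥)
insertAt-≟ˢ-⊥ W zero true  = ∷-≟ˢ-∷ true false W ⊥
insertAt-≟ˢ-⊥ W zero false = ∷-≟ˢ-∷ false false W ⊥
insertAt-≟ˢ-⊥ (true ∷ W) (suc e) b = begin
  (true ∷ insertAt W e b) ≟ˢ ⊥ ≡⟨ ∷-≟ˢ-∷ true false (insertAt W e b) ⊥ ⟩
  false                        ≡⟨ sym (∧-zeroʳ (not b)) ⟩
  not b ∧ false                ≡⟨ cong (not b ∧_) (sym (∷-≟ˢ-∷ true false W ⊥)) ⟩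
  not b ∧ ((true ∷ W) ≟ˢ ⊥)    ∎
  where open ≡-Reasoning
insertAt-≟ˢ-⊥ (false ∷ W) (suc e) b = begin
  (false ∷ insertAt W e b) ≟ˢ ⊥ ≡⟨ ∷-≟ˢ-∷ false false (insertAt W e b) ⊥ ⟩
  insertAt W e b ≟ˢ ⊥           ≡⟨ insertAt-≟ˢ-⊥ W e b ⟩
  not b ∧ (W ≟ˢ ⊥)              ≡⟨ cong (not b ∧_) (sym (∷-≟ˢ-∷ false false W ⊥)) ⟩
  not b ∧ ((false ∷ W) ≟ˢ ⊥)    ∎
  where open ≡-Reasoning

disjoint-insertAt : {n : ℕ} (W X : Subset n) (e : Fin (suc n)) (b c : Bool) →
  disjoint (insertAt W e b) (insertAt X e c) ≡ not (b ∧ c) ∧ disjoint W X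
disjoint-insertAt W X e b c =
  trans (cong (_≟ˢ ⊥) (insertAt-∩ W X e b c)) (insertAt-≟ˢ-⊥ (W ∩ X) e (b ∧ c))

disjoint-⊥ˡ : {n : ℕ} (X : Subset n) → disjoint ⊥ X ≡ true
disjoint-⊥ˡ X = trans (cong (_≟ˢ ⊥) (⊥-∩ X)) (≟ˢ-refl ⊥)
  where
  ⊥-∩ : {n : ℕ} (X : Subset n) → ⊥ ∩ X ≡ ⊥
  ⊥-∩ []      = refl
  ⊥-∩ (x ∷ X) = cong (false ∷_) (⊥-∩ X)

insertAt-injective : {A : Set} {n : ℕ} {W X : Vec A n} (e : Fin (suc n)) (b : A) →
  insertAt W e b ≡ insertAt X e b → W ≡ X
insertAt-injective {W = W} {X} e b eq = begin
  W                          ≡⟨ sym (removeAt-insertAt W e b) ⟩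
  removeAt (insertAt W e b) e ≡⟨ cong (λ Y → removeAt Y e) eq ⟩
  removeAt (insertAt X e b) e ≡⟨ removeAt-insertAt X e b ⟩
  X                          ∎
  where open ≡-Reasoning

∧≡if : (x c : Bool) → x ∧ c ≡ (if c then x else false)
∧≡if x true  = ∧-identityʳ x
∧≡if x false = ∧-zeroʳ x

𝟙-∧ : (c x : Bool) → 𝟙 (c ∧ x) ≡ (if c then 𝟙 x else 0)
𝟙-∧ true  x = refl
𝟙-∧ false x = refl

𝟙-∨-∧ : (a b d : Bool) → a ∧ b ≡ false → 𝟙 (a ∧ d) + 𝟙 (b ∧ d) ≡ 𝟙 ((a ∨ b) ∧ d)
𝟙-∨-∧ true  false d _ = +-identityʳ (𝟙 d)
𝟙-∨-∧ false b     d _ = refl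

module _ {n : ℕ} {e : Fin (suc n)} {S : Family (suc n)} (frame : Frame S e) where

  private
    ∅∈S : S ⊥ ≡ true
    ∅∈S = proj₁ frame

    ⁅e⁆∉S : S ⁅ e ⁆ ≡ false
    ⁅e⁆∉S = proj₁ (proj₂ frame)

    e∈nonempty : (Y : Subset (suc n)) → S Y ≡ true → Y ≢ ⊥ → e ∈ Y
    e∈nonempty = proj₂ (proj₂ frame)

  S-insertAt-false : (W : Subset n) → S (insertAt W e false) ≡ (W ≟ˢ ⊥)
  S-insertAt-false W with ≡-dec _≟ᵇ_ W ⊥
  ... | yes refl = trans (cong S (insertAt-⊥ e)) ∅∈S
  ... | no W≢⊥   = ¬-not e∉
    where
    nonempty : insertAt W e false ≢ ⊥
    nonempty eq = W≢⊥ (insertAt-injective e false (trans eq (sym (insertAt-⊥ e))))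

    e∉ : S (insertAt W e false) ≢ true
    e∉ W∈S with trans (sym ([]=⇒lookup (e∈nonempty _ W∈S nonempty))) (insertAt-lookup W e false)
    ... | ()

  S-insertAt-true-⊥ : S (insertAt ⊥ e true) ≡ false
  S-insertAt-true-⊥ = trans (cong S (sym (⁅⁆≡insertAt-⊥ e))) ⁅e⁆∉S

  S-insertAt-exclusive : (W : Subset n) → S (insertAt W e true) ∧ (W ≟ˢ ⊥) ≡ false
  S-insertAt-exclusive W with W ≟ˢ ⊥ in W≟⊥
  ... | false = ∧-zeroʳ _
  ... | true rewrite ≟ˢ⇒≡ W≟⊥ = trans (∧-identityʳ _) S-insertAt-true-⊥

  deleteFamily-insertAt : (Z : Subset n) → deleteFamily S e Z ≡ S (insertAt Z e true) ∨ (Z ≟ˢ ⊥)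
  deleteFamily-insertAt Z = begin
    deleteFamily S e Z
      ≡⟨ deleteFamily-⨁ S e Z ⟩
    Any.⨁ (λ Y → S Y ∧ (removeAt Y e ≟ˢ Z))
      ≡⟨ Any.⨁-insertAt e (λ Y → S Y ∧ (removeAt Y e ≟ˢ Z)) ⟩
    Any.⨁ (λ W → S (insertAt W e true) ∧ (removeAt (insertAt W e true) e ≟ˢ Z)) ∨
    Any.⨁ (λ W → S (insertAt W e false) ∧ (removeAt (insertAt W e false) e ≟ˢ Z))
      ≡⟨ cong₂ _∨_ (Any.⨁-cong (select true)) (Any.⨁-cong (select false)) ⟩
    Any.⨁ (λ W → if W ≟ˢ Z then S (insertAt W e true) else false) ∨
    Any.⨁ (λ W → if W ≟ˢ Z then S (insertAt W e false) else false)
      ≡⟨ cong₂ _∨_ (Any.⨁-delta (λ W → S (insertAt W e true)) Z) (Any.⨁-delta (λ W → S (insertAt W e false)) Z) ⟩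
    S (insertAt Z e true) ∨ S (insertAt Z e false)
      ≡⟨ cong (S (insertAt Z e true) ∨_) (S-insertAt-false Z) ⟩
    S (insertAt Z e true) ∨ (Z ≟ˢ ⊥) ∎
    where
    open ≡-Reasoning
    select : (b : Bool) (W : Subset n) →
      S (insertAt W e b) ∧ (removeAt (insertAt W e b) e ≟ˢ Z) ≡ (if W ≟ˢ Z then S (insertAt W e b) else false)
    select b W = trans (cong (λ V → S (insertAt W e b) ∧ (V ≟ˢ Z)) (removeAt-insertAt W e b))
                       (∧≡if (S (insertAt W e b)) (W ≟ˢ Z))

  countDisjoint-insertAt-false : (X : Subset n) →
    countDisjoint S (insertAt X e false) ≡ countDisjoint (deleteFamily S e) X
  countDisjoint-insertAt-false X = begin
    countDisjoint S (insertAt X e false)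
      ≡⟨ countDisjoint-⨁ S (insertAt X e false) ⟩
    Count.⨁ (λ Y → 𝟙 (S Y ∧ disjoint Y (insertAt X e false)))
      ≡⟨ Count.⨁-insertAt e (λ Y → 𝟙 (S Y ∧ disjoint Y (insertAt X e false))) ⟩
    Count.⨁ (λ W → 𝟙 (S (insertAt W e true) ∧ disjoint (insertAt W e true) (insertAt X e false))) +
    Count.⨁ (λ W → 𝟙 (S (insertAt W e false) ∧ disjoint (insertAt W e false) (insertAt X e false)))
      ≡⟨ cong₂ _+_
           (Count.⨁-cong λ W → cong (λ d → 𝟙 (S (insertAt W e true) ∧ d)) (disjoint-insertAt W X e true false))
           (Count.⨁-cong λ W → cong₂ (λ s d → 𝟙 (s ∧ d)) (S-insertAt-false W) (disjoint-insertAt W X e false false)) ⟩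
    Count.⨁ (λ W → 𝟙 (S (insertAt W e true) ∧ disjoint W X)) + Count.⨁ (λ W → 𝟙 ((W ≟ˢ ⊥) ∧ disjoint W X))
      ≡⟨ sym (Count.⨁-∙ (λ W → 𝟙 (S (insertAt W e true) ∧ disjoint W X)) (λ W → 𝟙 ((W ≟ˢ ⊥) ∧ disjoint W X))) ⟩
    Count.⨁ (λ W → 𝟙 (S (insertAt W e true) ∧ disjoint W X) + 𝟙 ((W ≟ˢ ⊥) ∧ disjoint W X))
      ≡⟨ Count.⨁-cong (λ W → trans (𝟙-∨-∧ (S (insertAt W e true)) (W ≟ˢ ⊥) (disjoint W X) (S-insertAt-exclusive W))
                                   (cong (λ s → 𝟙 (s ∧ disjoint W X)) (sym (deleteFamily-insertAt W)))) ⟩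
    Count.⨁ (λ W → 𝟙 (deleteFamily S e W ∧ disjoint W X))
      ≡⟨ sym (countDisjoint-⨁ (deleteFamily S e) X) ⟩
    countDisjoint (deleteFamily S e) X ∎
    where open ≡-Reasoning

  countDisjoint-insertAt-true : (X : Subset n) → countDisjoint S (insertAt X e true) ≡ 1
  countDisjoint-insertAt-true X = begin
    countDisjoint S (insertAt X e true)
      ≡⟨ countDisjoint-⨁ S (insertAt X e true) ⟩
    Count.⨁ (λ Y → 𝟙 (S Y ∧ disjoint Y (insertAt X e true)))
      ≡⟨ Count.⨁-insertAt e (λ Y → 𝟙 (S Y ∧ disjoint Y (insertAt X e true))) ⟩
    Count.⨁ (λ W → 𝟙 (S (insertAt W e true) ∧ disjoint (insertAt W e true) (insertAt X e true))) +
    Count.⨁ (λ W → 𝟙 (S (insertAt W e false) ∧ disjoint (insertAt W e false) (insertAt X e true)))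
      ≡⟨ cong₂ _+_ (Count.⨁-cong none) (Count.⨁-cong only-⊥) ⟩
    Count.⨁ {n} (λ _ → 0) + Count.⨁ (λ W → if W ≟ˢ ⊥ then 𝟙 (disjoint W X) else 0)
      ≡⟨ cong₂ _+_ (Count.⨁-ε {n}) (Count.⨁-delta (λ W → 𝟙 (disjoint W X)) ⊥) ⟩
    𝟙 (disjoint ⊥ X)
      ≡⟨ cong 𝟙 (disjoint-⊥ˡ X) ⟩
    1 ∎
    where
    open ≡-Reasoning
    none : (W : Subset n) → 𝟙 (S (insertAt W e true) ∧ disjoint (insertAt W e true) (insertAt X e true)) ≡ 0
    none W = cong 𝟙 (trans (cong (S (insertAt W e true) ∧_) (disjoint-insertAt W X e true true)) (∧-zeroʳ _))
    only-⊥ : (W : Subset n) →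
      𝟙 (S (insertAt W e false) ∧ disjoint (insertAt W e false) (insertAt X e true)) ≡ (if W ≟ˢ ⊥ then 𝟙 (disjoint W X) else 0)
    only-⊥ W = trans (cong₂ (λ s d → 𝟙 (s ∧ d)) (S-insertAt-false W) (disjoint-insertAt W X e false true))
                     (𝟙-∧ (W ≟ˢ ⊥) (disjoint W X))

theorem4 : (n : ℕ) (e : Fin (suc n)) (S : Family (suc n)) → Frame S e →
    (Powerful (deleteFamily S e) ⇔ Powerful S)
theorem4 n e S frame = mk⇔ extend restrict
  where
  PowerOf2 : ℕ → Set
  PowerOf2 m = ∃ λ k → m ≡ 2 ^ k

  restrict : Powerful S → Powerful (deleteFamily S e)
  restrict pS X = map₂ (trans (sym (countDisjoint-insertAt-false frame X))) (pS (insertAt X e false))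

  split : (X : Subset n) (b : Bool) → Powerful (deleteFamily S e) → PowerOf2 (countDisjoint S (insertAt X e b))
  split X true  _  = 0 , countDisjoint-insertAt-true frame X
  split X false pD = map₂ (trans (countDisjoint-insertAt-false frame X)) (pD X)

  extend : Powerful (deleteFamily S e) → Powerful S
  extend pD X = subst (PowerOf2 ∘ countDisjoint S) (insertAt-removeAt X e) (split (removeAt X e) (lookup X e) pD)
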